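{- Let $G=(V,E)$ be a graph and let $(A,B,D,M)$ be a nice decomposition of $G$. Then $|M|+|\hat{\mathcal{C}}_3|=2LP(G)-MM(G)$, and every vertex cover of $G$ has size at least $|M|+|\hat{\mathcal{C}}_3|$.
   Context: Graphs are finite, simple and undirected; $N(D)$ denotes the set of vertices not in $D$ that have a neighbor in $D$. A graph is factor-critical if deleting any single vertex leaves a graph with a perfect matching. A relaxed Gallai-Edmonds decomposition of $G=(V,E)$ is a tuple $(A,B,D,M)$ with $V=A\,\dot\cup\, B\,\dot\cup\, D$ and $M$ a maximum matching of $G$ such that: (1) $A=N(D)$; (2) each connected component of $G[D]$ is factor-critical; (3) $M$ restricted to $B$ is a perfect matching of $G[B]$; (4) $M$ restricted to any component $C$ of $G[D]$ is a near-perfect matching of $G[C]$; (5) each vertex of $A$ is matched by $M$ to a vertex of $D$. A component $C$ of $G[D]$ is matched if some edge of $M$ joins a vertex of $C$ to a vertex of $A$, and unmatched otherwise. $\hat{\mathcal{C}}_1$ is the set of unmatched single-vertex components of $G[D]$ and $\hat{\mathcal{C}}_3$ the set of unmatched components with more than one vertex. The decomposition is nice if $\hat{\mathcal{C}}_1=\emptyset$. $LP(G)$ is the minimum cost $\sum_v x(v)$ of a fractional vertex cover $x\colon V\to\mathbb{R}_{\ge0}$ (with $x(u)+x(v)\ge1$ for every edge), and $MM(G)$ is the maximum size of a matching of $G$.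
   Formalization: The fractional vertex covers defining $LP(G)$ take rational values instead of real ones. -}

module Defs where

open import Data.Nat using (ℕ; zero; suc; _≤_; _≤ᵇ_; _+_)
open import Data.Fin using (Fin; toℕ)
open import Data.Fin.Properties using () renaming (_≟_ to _≟ᶠ_)
open import Data.Bool using (Bool; true; false; T; _∧_; _∨_; not)
open import Data.Bool.Properties using (T?)
open import Data.List using (List; []; _∷_; length; filter; concatMap; foldr; allFin)
open import Data.Bool.ListAction using (any; all)
open import Data.List.Membership.Propositional using (_∈_; _∉_)
open import Data.List.Relation.Unary.All using (All)
open import Data.List.Relation.Unary.Unique.Propositional using (Unique)
open import Data.Product using (Σ; ∃; _×_; _,_; proj₁; proj₂)
open import Data.Sum using (_⊎_)
open import Relation.Binary.PropositionalEquality using (_≡_; _≢_)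
open import Relation.Nullary using (¬_; does)
open import Data.Rational using (ℚ; 0ℚ; 1ℚ) renaming (_+_ to _+ℚ_; _≤_ to _≤ℚ_)

record Graph (n : ℕ) : Set where
  field
    adj   : Fin n → Fin n → Bool
    sym   : ∀ u v → adj u v ≡ adj v u
    irrfl : ∀ v → adj v v ≡ false
open Graph public

Edge : ∀ {n} → Graph n → Fin n → Fin n → Set
Edge G u v = T (adj G u v)

VSet : ℕ → Set
VSet n = Fin n → Bool

_∈ᵛ_ : ∀ {n} → Fin n → VSet n → Set
v ∈ᵛ S = T (S v)

eqᶠ : ∀ {n} → Fin n → Fin n → Bool
eqᶠ u v = does (u ≟ᶠ v)

_─_ : ∀ {n} → VSet n → Fin n → VSet n
(S ─ v) u = S u ∧ not (eqᶠ u v)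

size : ∀ {n} → VSet n → ℕ
size {n} S = length (filter (λ v → T? (S v)) (allFin n))

Matching : ℕ → Set
Matching n = List (Fin n × Fin n)

verts : ∀ {n} → Matching n → List (Fin n)
verts = concatMap (λ e → proj₁ e ∷ proj₂ e ∷ [])

IsMatching : ∀ {n} → Graph n → Matching n → Set
IsMatching G M = All (λ e → Edge G (proj₁ e) (proj₂ e)) M × Unique (verts M)

MEdge : ∀ {n} → Matching n → Fin n → Fin n → Set
MEdge M u v = (u , v) ∈ M ⊎ (v , u) ∈ M

MEdgeB : ∀ {n} → Matching n → Fin n → Fin n → Bool
MEdgeB M u v = any (λ e → (eqᶠ (proj₁ e) u ∧ eqᶠ (proj₂ e) v) ∨ (eqᶠ (proj₁ e) v ∧ eqᶠ (proj₂ e) u)) M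

inside : ∀ {n} → VSet n → Fin n × Fin n → Bool
inside S e = S (proj₁ e) ∧ S (proj₂ e)

restrict : ∀ {n} → Matching n → VSet n → Matching n
restrict M S = filter (λ e → T? (inside S e)) M

PerfectMatchingOf : ∀ {n} → Graph n → VSet n → Matching n → Set
PerfectMatchingOf G S M =
  IsMatching G M × All (λ e → T (inside S e)) M × (∀ v → v ∈ᵛ S → v ∈ verts M)

NearPerfectMatchingOf : ∀ {n} → Graph n → VSet n → Matching n → Set
NearPerfectMatchingOf G S M =
  IsMatching G M × All (λ e → T (inside S e)) M ×
  Σ _ (λ w → w ∈ᵛ S × w ∉ verts M × (∀ v → v ∈ᵛ S → v ≢ w → v ∈ verts M))

FactorCritical : ∀ {n} → Graph n → VSet n → Set
FactorCritical G S = ∀ v → v ∈ᵛ S → Σ _ (λ M′ → PerfectMatchingOf G (S ─ v) M′)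

IsMaximumMatching : ∀ {n} → Graph n → Matching n → Set
IsMaximumMatching G M = IsMatching G M × (∀ M′ → IsMatching G M′ → length M′ ≤ length M)

IsMM : ∀ {n} → Graph n → ℕ → Set
IsMM G k = Σ _ (λ M → IsMatching G M × length M ≡ k) × (∀ M′ → IsMatching G M′ → length M′ ≤ k)

reach : ∀ {n} → Graph n → VSet n → ℕ → Fin n → Fin n → Bool
reach {n} G D zero    u v = D u ∧ eqᶠ u v
reach {n} G D (suc k) u v =
  reach G D k u v ∨ any (λ w → reach G D k u w ∧ adj G w v ∧ D v) (allFin n)

-- for u ∈ D: the vertex set of the component of G[D] containing u
comp : ∀ {n} → Graph n → VSet n → Fin n → VSet n
comp {n} G D u = reach G D n u

-- (A,B,D) given by a labelling of the vertices (so V = A ⊍ B ⊍ D)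

data Part : Set where
  inA inB inD : Part

isA isB isD : Part → Bool
isA inA = true
isA _   = false
isB inB = true
isB _   = false
isD inD = true
isD _   = false

module _ {n : ℕ} (G : Graph n) (part : Fin n → Part) (M : Matching n) where

  Aset Bset Dset : VSet n
  Aset v = isA (part v)
  Bset v = isB (part v)
  Dset v = isD (part v)

  -- component of u (u ∈ D) is matched: some M-edge joins it to A
  matchedB : Fin n → Bool
  matchedB u = any (λ c → comp G Dset u c ∧ any (λ a → Aset a ∧ MEdgeB M c a) (allFin n)) (allFin n)

  nontrivB : Fin n → Bool
  nontrivB u = any (λ v → comp G Dset u v ∧ not (eqᶠ u v)) (allFin n)

  -- u is the smallest vertex of its component (the component's representative)
  repB : Fin n → Bool
  repB u = all (λ v → not (comp G Dset u v) ∨ (toℕ u ≤ᵇ toℕ v)) (allFin n)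

  -- |Ĉ₃|: number of unmatched components of G[D] with more than one vertex
  C3count : ℕ
  C3count = size (λ u → Dset u ∧ repB u ∧ not (matchedB u) ∧ nontrivB u)

  record IsRelaxedGED : Set where
    field
      maxM  : IsMaximumMatching G M
      A⇒N   : ∀ v → v ∈ᵛ Aset → ¬ (v ∈ᵛ Dset) × Σ _ (λ u → u ∈ᵛ Dset × Edge G u v)
      N⇒A   : ∀ v → ¬ (v ∈ᵛ Dset) → Σ _ (λ u → u ∈ᵛ Dset × Edge G u v) → v ∈ᵛ Aset
      fc    : ∀ u → u ∈ᵛ Dset → FactorCritical G (comp G Dset u)
      perfB : PerfectMatchingOf G Bset (restrict M Bset)
      nearC : ∀ u → u ∈ᵛ Dset →
              NearPerfectMatchingOf G (comp G Dset u) (restrict M (comp G Dset u))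
      matA  : ∀ a → a ∈ᵛ Aset → Σ _ (λ d → d ∈ᵛ Dset × MEdge M a d)

  -- nice: Ĉ₁ = ∅, i.e. no unmatched single-vertex component of G[D]
  Nice : Set
  Nice = ¬ Σ _ (λ u → u ∈ᵛ Dset × T (not (matchedB u)) × (∀ v → v ∈ᵛ comp G Dset u → v ≡ u))

cost : ∀ {n} → (Fin n → ℚ) → ℚ
cost {n} x = foldr (λ v acc → x v +ℚ acc) 0ℚ (allFin n)

FracCover : ∀ {n} → Graph n → (Fin n → ℚ) → Set
FracCover G x = (∀ v → 0ℚ ≤ℚ x v) × (∀ u v → Edge G u v → 1ℚ ≤ℚ x u +ℚ x v)

IsLP : ∀ {n} → Graph n → ℚ → Set
IsLP G q = Σ _ (λ x → FracCover G x × cost x ≡ q) × (∀ x → FracCover G x → q ≤ℚ cost x)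

IsVertexCover : ∀ {n} → Graph n → VSet n → Set
IsVertexCover G S = ∀ u v → Edge G u v → T (S u ∨ S v)

-- Let M be the matching of a nice decomposition. An M-exposed vertex u lies in D; its component C
-- of G[D] is unmatched (M would otherwise leave C towards A = N(D)), contains no other exposed vertex,
-- and by niceness has more than one vertex. Conversely the vertex missed by the near-perfect matching
-- of an unmatched component is exposed. Hence |Ĉ₃| is the number of exposed vertices, |V| = 2|M| + |Ĉ₃|
-- and MM(G) = |M|, so the theorem says LP(G) = |V|/2 and that vertex covers have at least |M| + |Ĉ₃|
-- vertices.
--
-- Call a vertex heavy if it lies in a given vertex cover S, or has weight at least ½ in a given
-- fractional cover x. Deleting some v ≠ u from the factor-critical C leaves a perfect matching; its edge
-- at u has a heavy end z. Following a perfect matching of C − z inside each such C, and M elsewhere,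
-- gives an involution σ of V that moves every vertex along an edge and fixes exactly one heavy vertex
-- per exposed component. Summing the weights of v and σ v over all v gives 2|S| ≥ |V| + |Ĉ₃| and
-- 2 x(V) ≥ |V|; the all-½ cover costs |V|/2.

module Submission where

open import Defs hiding (sym)
open import Algebra.Bundles using (CommutativeMonoid)
import Algebra.Properties.CommutativeMonoid.Sum as CommutativeMonoidSum
open import Data.Bool using (Bool; true; false; T; not; _∧_; _∨_; if_then_else_)
open import Data.Bool.Properties using (T?; T-∧; T-∨)
open import Data.Bool.ListAction using (any; all)
open import Data.Empty using (⊥)
open import Data.Fin using (Fin; zero; suc; toℕ)
open import Data.Fin.Permutation using (permutation)
import Data.Fin.Permutation.Components as Perm
open import Data.Fin.Properties using (any?; all?; ¬∀⟶∃¬; toℕ-injective) renaming (_≟_ to _≟ᶠ_)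
open import Data.Integer using (+_)
import Data.Integer as ℤ
import Data.Integer.Tactic.RingSolver as ℤ-Solver
open import Data.List using (List; []; _∷_; length; filter; foldr; allFin; tabulate)
open import Data.List.Membership.Propositional using (_∈_; _∉_; lose; find)
open import Data.List.Membership.Propositional.Properties using (∈-allFin; ∈-filter⁺; ∈-filter⁻)
import Data.List.Membership.DecPropositional as DecMembership
open import Data.List.Relation.Unary.All as All using (All)
open import Data.List.Relation.Unary.All.Properties using (all⁺; all⁻)
open import Data.List.Relation.Unary.Any using (here; there; satisfied)
open import Data.List.Relation.Unary.Any.Properties using (any⁺; any⁻)
open import Data.List.Relation.Unary.AllPairs using (_∷_)
open import Data.List.Relation.Unary.Unique.Propositional using (Unique)
open import Data.Nat using (ℕ; zero; suc; _+_; _≤_; _<_; _≤ᵇ_; z≤n; s≤s)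
import Data.Nat.Properties as ℕ
open import Data.Nat.Tactic.RingSolver using (solve-∀)
open import Data.Product using (Σ; ∃; _×_; _,_; proj₁; proj₂)
open import Data.Rational using (ℚ; 0ℚ; 1ℚ; ½; _/_; toℚᵘ) renaming (_+_ to _+ℚ_; _≤_ to _≤ℚ_)
open import Data.Rational.Unnormalised using (mkℚᵘ; *≡*) renaming (_+_ to _+ᵘ_)
import Data.Rational.Unnormalised.Properties as ℚᵘ
import Data.Rational.Properties as ℚ
open import Data.Sum using (_⊎_; inj₁; inj₂)
open import Data.Unit using (tt)
open import Function using (_∘_; id; _⇔_; Equivalence; mk⇔)
open import Relation.Binary.PropositionalEquality
  using (_≡_; _≢_; refl; sym; trans; cong; cong₂; subst; module ≡-Reasoning)
open import Relation.Nullary using (¬_; Dec; yes; no; does; contradiction; ¬?)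
open import Relation.Nullary.Decidable
  using (dec-true; dec-false; does-⇔; map′; _→-dec_; _×-dec_; recompute; decidable-stable)
open import Relation.Unary using (Decidable)

open Equivalence using (to; from)

private
  variable
    n : ℕ

any-allFin⁻ : (p : Fin n → Bool) → T (any p (allFin n)) → ∃ λ v → T (p v)
any-allFin⁻ {n} p = satisfied ∘ any⁻ p (allFin n)

any-allFin⁺ : (p : Fin n → Bool) (v : Fin n) → T (p v) → T (any p (allFin n))
any-allFin⁺ p v pv = any⁺ p (lose (∈-allFin v) pv)

all-allFin⁻ : (p : Fin n → Bool) → T (all p (allFin n)) → ∀ v → T (p v)
all-allFin⁻ p t v = All.lookup (all⁺ p _ t) (∈-allFin v)

all-allFin⁺ : (p : Fin n → Bool) → (∀ v → T (p v)) → T (all p (allFin n))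
all-allFin⁺ {n} p h = all⁻ p {xs = allFin n} (All.tabulate (λ {v} _ → h v))

eqᶠ⇒≡ : {u v : Fin n} → T (eqᶠ u v) → u ≡ v
eqᶠ⇒≡ {u = u} {v} t with u ≟ᶠ v
... | yes u≡v = u≡v

eqᶠ-refl : (v : Fin n) → T (eqᶠ v v)
eqᶠ-refl v = subst T (sym (dec-true (v ≟ᶠ v) refl)) tt

¬T⇒T-not : ∀ {b} → ¬ T b → T (not b)
¬T⇒T-not {false} _  = tt
¬T⇒T-not {true}  ¬t = ¬t tt

T-not⇒¬T : ∀ {b} → T (not b) → ¬ T b
T-not⇒¬T {false} _ ()

¬[⇒] : {A B : Set} → Dec A → ¬ (A → B) → A × ¬ B
¬[⇒] (yes a) a⇏b = a , λ b → a⇏b (λ _ → b)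
¬[⇒] (no ¬a) a⇏b = contradiction (λ a → contradiction a ¬a) a⇏b

≢⇒T-not-eqᶠ : {u v : Fin n} → u ≢ v → T (not (eqᶠ u v))
≢⇒T-not-eqᶠ {u = u} {v} u≢v = ¬T⇒T-not (u≢v ∘ eqᶠ⇒≡)

∈-─⁺ : {S : VSet n} {u v : Fin n} → u ∈ᵛ S → u ≢ v → u ∈ᵛ (S ─ v)
∈-─⁺ u∈S u≢v = from T-∧ (u∈S , ≢⇒T-not-eqᶠ u≢v)

∈-─⁻ : {S : VSet n} {u v : Fin n} → u ∈ᵛ (S ─ v) → u ∈ᵛ S × u ≢ v
∈-─⁻ {S = S} {u} u∈S─v =
  let u∈S , u≉v = to (T-∧ {S u}) u∈S─v
  in u∈S , λ u≡v → T-not⇒¬T u≉v (subst (T ∘ eqᶠ u) u≡v (eqᶠ-refl u))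

-- Sums and counting over Fin n

module InvolutionSum {c ℓ} (M : CommutativeMonoid c ℓ) where
  open CommutativeMonoid M
  open CommutativeMonoidSum M using (sum; sum-permute)

  sum-∘-involution : (ι : Fin n → Fin n) → (∀ v → ι (ι v) ≡ v) →
                     ∀ f → sum f ≈ sum (f ∘ ι)
  sum-∘-involution ι ι-inv f = sum-permute f (permutation ι ι ι-inv ι-inv)

module ℕΣ = CommutativeMonoidSum ℕ.+-0-commutativeMonoid
module ℚΣ = CommutativeMonoidSum ℚ.+-0-commutativeMonoid
open InvolutionSum ℕ.+-0-commutativeMonoid renaming (sum-∘-involution to ℕsum-∘-involution)
open InvolutionSum ℚ.+-0-commutativeMonoid renaming (sum-∘-involution to ℚsum-∘-involution)

ℕsum-mono-≤ : {f g : Fin n → ℕ} → (∀ v → f v ≤ g v) → ℕΣ.sum f ≤ ℕΣ.sum g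
ℕsum-mono-≤ {zero}  f≤g = z≤n
ℕsum-mono-≤ {suc n} f≤g = ℕ.+-mono-≤ (f≤g zero) (ℕsum-mono-≤ (f≤g ∘ suc))

ℚsum-mono-≤ : {f g : Fin n → ℚ} → (∀ v → f v ≤ℚ g v) → ℚΣ.sum f ≤ℚ ℚΣ.sum g
ℚsum-mono-≤ {zero}  f≤g = ℚ.≤-refl
ℚsum-mono-≤ {suc n} f≤g = ℚ.+-mono-≤ (f≤g zero) (ℚsum-mono-≤ (f≤g ∘ suc))

ℕsum-≤-pairs : (ι : Fin n → Fin n) → (∀ v → ι (ι v) ≡ v) → {c w : Fin n → ℕ} →
               (∀ v → c v ≤ w v + w (ι v)) → ℕΣ.sum c ≤ ℕΣ.sum w + ℕΣ.sum w
ℕsum-≤-pairs {n} ι ι-inv {c} {w} c≤ = ℕ.≤-trans (ℕsum-mono-≤ c≤) (ℕ.≤-reflexive (begin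
  ℕΣ.sum (λ v → w v + w (ι v))  ≡⟨ ℕΣ.∑-distrib-+ {n} w (w ∘ ι) ⟩
  ℕΣ.sum w + ℕΣ.sum (w ∘ ι)     ≡⟨ cong (λ t → ℕΣ.sum w + t) (ℕsum-∘-involution ι ι-inv w) ⟨
  ℕΣ.sum w + ℕΣ.sum w           ∎))
  where open ≡-Reasoning

ℚsum-≤-pairs : (ι : Fin n → Fin n) → (∀ v → ι (ι v) ≡ v) → {c w : Fin n → ℚ} →
               (∀ v → c v ≤ℚ w v +ℚ w (ι v)) → ℚΣ.sum c ≤ℚ ℚΣ.sum w +ℚ ℚΣ.sum w
ℚsum-≤-pairs {n} ι ι-inv {c} {w} c≤ = ℚ.≤-trans (ℚsum-mono-≤ c≤) (ℚ.≤-reflexive (begin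
  ℚΣ.sum (λ v → w v +ℚ w (ι v))  ≡⟨ ℚΣ.∑-distrib-+ {n} w (w ∘ ι) ⟩
  ℚΣ.sum w +ℚ ℚΣ.sum (w ∘ ι)     ≡⟨ cong (ℚΣ.sum w +ℚ_) (ℚsum-∘-involution ι ι-inv w) ⟨
  ℚΣ.sum w +ℚ ℚΣ.sum w           ∎))
  where open ≡-Reasoning

ℕhalve-≤ : {a b : ℕ} → a + a ≤ b + b → a ≤ b
ℕhalve-≤ a+a≤b+b = ℕ.≮⇒≥ (λ b<a → ℕ.<⇒≱ (ℕ.+-mono-< b<a b<a) a+a≤b+b)

ℚhalve-≤ : {a b : ℚ} → a +ℚ a ≤ℚ b +ℚ b → a ≤ℚ b
ℚhalve-≤ a+a≤b+b = ℚ.≮⇒≥ (λ b<a → ℚ.<-irrefl refl (ℚ.<-≤-trans (ℚ.+-mono-< b<a b<a) a+a≤b+b))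

sum-½ : ∀ n → ℚΣ.sum {n} (λ _ → ½) ≡ (+ n) / 2
sum-½ zero    = refl
sum-½ (suc n) = ℚ.toℚᵘ-injective (begin
  toℚᵘ (½ +ℚ ℚΣ.sum {n} (λ _ → ½))      ≈⟨ ℚ.toℚᵘ-homo-+ ½ (ℚΣ.sum {n} (λ _ → ½)) ⟩
  toℚᵘ ½ +ᵘ toℚᵘ (ℚΣ.sum {n} (λ _ → ½)) ≡⟨ cong (λ q → toℚᵘ ½ +ᵘ toℚᵘ q) (sum-½ n) ⟩
  toℚᵘ ½ +ᵘ toℚᵘ ((+ n) / 2)            ≈⟨ ℚᵘ.+-congʳ (toℚᵘ ½) (ℚ.toℚᵘ-fromℚᵘ (mkℚᵘ (+ n) 1)) ⟩
  toℚᵘ ½ +ᵘ mkℚᵘ (+ n) 1               ≈⟨ *≡* (half-step (+ n)) ⟩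
  mkℚᵘ (+ suc n) 1                     ≈⟨ ℚ.toℚᵘ-fromℚᵘ (mkℚᵘ (+ suc n) 1) ⟨
  toℚᵘ ((+ suc n) / 2)                 ∎)
  where
  open ℚᵘ.≃-Reasoning
  -- (+ k) / 2 unfolds to fromℚᵘ (mkℚᵘ (+ k) 1), whose denominator field stores 2 ∸ 1;
  -- half-step is ½ + n/2 ≃ (1 + n)/2 cross-multiplied.
  half-step : ∀ x → (+ 1 ℤ.* + 2 ℤ.+ x ℤ.* + 2) ℤ.* + 2 ≡ (+ 1 ℤ.+ x) ℤ.* + 4
  half-step = ℤ-Solver.solve-∀

indicator : Bool → ℕ
indicator b = if b then 1 else 0

indicator-mono : ∀ {a b} → (T a → T b) → indicator a ≤ indicator b
indicator-mono {false}         _    = z≤n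
indicator-mono {true}  {true}  _    = s≤s z≤n
indicator-mono {true}  {false} a⇒b = contradiction tt a⇒b

indicator-< : ∀ {a b} → ¬ T a → T b → indicator a < indicator b
indicator-< {false} {true} _  _ = s≤s z≤n
indicator-< {true}         ¬a _ = contradiction tt ¬a

count : (Fin n → Bool) → ℕ
count p = ℕΣ.sum (indicator ∘ p)

size≡count : (S : VSet n) → size S ≡ count S
size≡count {n} S = go n id
  where
  go : ∀ m (h : Fin m → Fin n) → length (filter (T? ∘ S) (tabulate h)) ≡ count (S ∘ h)
  go zero    h = refl
  go (suc m) h with S (h zero)
  ... | true  = cong suc (go m (h ∘ suc))
  ... | false = go m (h ∘ suc)

cost≡sum : (x : Fin n → ℚ) → cost x ≡ ℚΣ.sum x
cost≡sum {n} x = go n id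
  where
  go : ∀ m (h : Fin m → Fin n) → foldr (λ v acc → x v +ℚ acc) 0ℚ (tabulate h) ≡ ℚΣ.sum (x ∘ h)
  go zero    h = refl
  go (suc m) h = cong (x (h zero) +ℚ_) (go m (h ∘ suc))

count-cong : {P Q : Fin n → Set} (P? : Decidable P) (Q? : Decidable Q) →
             (∀ v → P v ⇔ Q v) → count (does ∘ P?) ≡ count (does ∘ Q?)
count-cong P? Q? P⇔Q = ℕΣ.sum-cong-≗ (λ v → cong indicator (does-⇔ (P⇔Q v) (P? v) (Q? v)))

count-∘-involution : (ι : Fin n → Fin n) → (∀ v → ι (ι v) ≡ v) →
                     (p : Fin n → Bool) → count p ≡ count (p ∘ ι)
count-∘-involution ι ι-inv p = ℕsum-∘-involution ι ι-inv (indicator ∘ p)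

count-all : count {n} (λ _ → true) ≡ n
count-all {zero}  = refl
count-all {suc n} = cong suc (count-all {n})

count-mono : {p q : Fin n → Bool} → (∀ v → T (p v) → T (q v)) → count p ≤ count q
count-mono p⊆q = ℕsum-mono-≤ (λ v → indicator-mono (p⊆q v))

count-≤ : (p : Fin n → Bool) → count p ≤ n
count-≤ {n} p = ℕ.≤-trans (count-mono {p = p} {q = λ _ → true} (λ _ _ → tt)) (ℕ.≤-reflexive (count-all {n}))

count-mono-< : {p q : Fin n → Bool} → (∀ v → T (p v) → T (q v)) →
               ∀ v → ¬ T (p v) → T (q v) → count p < count q
count-mono-< p⊆q zero    ¬pv qv = ℕ.+-mono-<-≤ (indicator-< ¬pv qv) (count-mono (p⊆q ∘ suc))
count-mono-< p⊆q (suc v) ¬pv qv =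
  ℕ.+-mono-≤-< (indicator-mono (p⊆q zero)) (count-mono-< (p⊆q ∘ suc) v ¬pv qv)

count-+-not : (p : Fin n → Bool) → count p + count (not ∘ p) ≡ n
count-+-not {n} p = begin
  count p + count (not ∘ p)
    ≡⟨ ℕΣ.∑-distrib-+ {n} (indicator ∘ p) (indicator ∘ not ∘ p) ⟨
  ℕΣ.sum (λ v → indicator (p v) + indicator (not (p v)))
    ≡⟨ ℕΣ.sum-cong-≗ {n} (λ v → split (p v)) ⟩
  count {n} (λ _ → true)
    ≡⟨ count-all ⟩
  n ∎
  where
  open ≡-Reasoning
  split : ∀ b → indicator b + indicator (not b) ≡ 1
  split true  = refl
  split false = refl

count-singleton : (x : Fin n) → count (λ v → eqᶠ v x) ≡ 1
count-singleton {suc n} zero    = cong suc (ℕΣ.sum-replicate-zero n)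
count-singleton {suc n} (suc x) = count-singleton x

-- Matchings

_∈?_ : (v : Fin n) (xs : List (Fin n)) → Dec (v ∈ xs)
_∈?_ = DecMembership._∈?_ _≟ᶠ_

count-∈ : (xs : List (Fin n)) → Unique xs → count (λ v → does (v ∈? xs)) ≡ length xs
count-∈ {n} []       _              = ℕΣ.sum-replicate-zero n
count-∈ {n} (x ∷ xs) (x∉xs ∷ uniq) = begin
  count (λ v → does (v ∈? (x ∷ xs)))                     ≡⟨ ℕΣ.sum-cong-≗ {n} split ⟩
  ℕΣ.sum (λ v → indicator (eqᶠ v x) + indicator (does (v ∈? xs)))
    ≡⟨ ℕΣ.∑-distrib-+ {n} (λ v → indicator (eqᶠ v x)) (λ v → indicator (does (v ∈? xs))) ⟩
  count (λ v → eqᶠ v x) + count (λ v → does (v ∈? xs))  ≡⟨ cong₂ _+_ (count-singleton x) (count-∈ xs uniq) ⟩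
  suc (length xs)                                        ∎
  where
  open ≡-Reasoning
  split : ∀ v → indicator (does (v ∈? (x ∷ xs))) ≡ indicator (eqᶠ v x) + indicator (does (v ∈? xs))
  split v with v ≟ᶠ x
  ... | yes refl = cong (suc ∘ indicator) (sym (dec-false (v ∈? xs) (λ v∈xs → All.lookup x∉xs v∈xs refl)))
  ... | no _     = refl

MEdge-sym : {L : Matching n} {v w : Fin n} → MEdge L v w → MEdge L w v
MEdge-sym (inj₁ vw∈L) = inj₂ vw∈L
MEdge-sym (inj₂ wv∈L) = inj₁ wv∈L

∈⇒∈-verts : {L : Matching n} {a b : Fin n} → (a , b) ∈ L → a ∈ verts L × b ∈ verts L
∈⇒∈-verts (here refl) = here refl , there (here refl)
∈⇒∈-verts {L = _ ∷ L} (there ab∈L) =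
  let a∈ , b∈ = ∈⇒∈-verts {L = L} ab∈L in there (there a∈) , there (there b∈)

MEdge⇒∈-verts : {L : Matching n} {v w : Fin n} → MEdge L v w → v ∈ verts L × w ∈ verts L
MEdge⇒∈-verts (inj₁ vw∈L) = ∈⇒∈-verts vw∈L
MEdge⇒∈-verts (inj₂ wv∈L) = let w∈ , v∈ = ∈⇒∈-verts wv∈L in v∈ , w∈

length-verts : (L : Matching n) → length (verts L) ≡ length L + length L
length-verts []      = refl
length-verts (_ ∷ L) = cong suc (trans (cong suc (length-verts L)) (sym (ℕ.+-suc (length L) (length L))))

partner : Matching n → Fin n → Fin n
partner []            v = v
partner ((a , b) ∷ L) v with v ≟ᶠ a | v ≟ᶠ b
... | yes _ | _     = b
... | no _  | yes _ = a
... | no _  | no _  = partner L v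

module _ {L : Matching n} {a b : Fin n} where

  partner-head₁ : partner ((a , b) ∷ L) a ≡ b
  partner-head₁ with a ≟ᶠ a
  ... | yes _  = refl
  ... | no a≢a = contradiction refl a≢a

  partner-head₂ : a ≢ b → partner ((a , b) ∷ L) b ≡ a
  partner-head₂ a≢b with b ≟ᶠ a | b ≟ᶠ b
  ... | yes b≡a | _      = contradiction (sym b≡a) a≢b
  ... | no _    | yes _  = refl
  ... | no _    | no b≢b = contradiction refl b≢b

  partner-tail : {v : Fin n} → v ≢ a → v ≢ b → partner ((a , b) ∷ L) v ≡ partner L v
  partner-tail {v} v≢a v≢b with v ≟ᶠ a | v ≟ᶠ b
  ... | yes v≡a | _       = contradiction v≡a v≢a
  ... | no _    | yes v≡b = contradiction v≡b v≢b
  ... | no _    | no _    = refl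

partner-fixed : (L : Matching n) (v : Fin n) → v ∉ verts L → partner L v ≡ v
partner-fixed []            v v∉ = refl
partner-fixed ((a , b) ∷ L) v v∉ =
  trans (partner-tail (v∉ ∘ here) (v∉ ∘ there ∘ here)) (partner-fixed L v (v∉ ∘ there ∘ there))

partner-MEdge : (L : Matching n) (v : Fin n) → v ∈ verts L → MEdge L v (partner L v)
partner-MEdge ((a , b) ∷ L) v v∈ with v ≟ᶠ a | v ≟ᶠ b | v∈
... | yes refl | _        | _                = inj₁ (here refl)
... | no _     | yes refl | _                = inj₂ (here refl)
... | no v≢a   | no _     | here v≡a         = contradiction v≡a v≢a
... | no _     | no v≢b   | there (here v≡b) = contradiction v≡b v≢b
... | no _     | no _     | there (there v∈L) with partner-MEdge L v v∈L
...   | inj₁ vw∈L = inj₁ (there vw∈L)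
...   | inj₂ wv∈L = inj₂ (there wv∈L)

partner-unique : (L : Matching n) → Unique (verts L) → {v w : Fin n} → MEdge L v w → partner L v ≡ w
partner-unique ((a , b) ∷ L) _            (inj₁ (here refl)) = partner-head₁ {L = L} {a} {b}
partner-unique ((a , b) ∷ L) (a∉ ∷ _ ∷ _) (inj₂ (here refl)) =
  partner-head₂ {L = L} {a} {b} (All.lookup a∉ (here refl))
partner-unique (_ ∷ L) (a∉ ∷ b∉ ∷ uniq) {v} (inj₁ (there vw∈L)) =
  trans (partner-tail (λ v≡a → All.lookup a∉ (there v∈) (sym v≡a)) (λ v≡b → All.lookup b∉ v∈ (sym v≡b)))
        (partner-unique L uniq (inj₁ vw∈L))
  where v∈ = proj₁ (∈⇒∈-verts vw∈L)
partner-unique (_ ∷ L) (a∉ ∷ b∉ ∷ uniq) {v} (inj₂ (there wv∈L)) =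
  trans (partner-tail (λ v≡a → All.lookup a∉ (there v∈) (sym v≡a)) (λ v≡b → All.lookup b∉ v∈ (sym v≡b)))
        (partner-unique L uniq (inj₂ wv∈L))
  where v∈ = proj₂ (∈⇒∈-verts wv∈L)

partner-involutive : (L : Matching n) → Unique (verts L) → ∀ v → partner L (partner L v) ≡ v
partner-involutive L uniq v with v ∈? verts L
... | yes v∈ = partner-unique L uniq (MEdge-sym (partner-MEdge L v v∈))
... | no v∉  = trans (cong (partner L) (partner-fixed L v v∉)) (partner-fixed L v v∉)

MEdgeB⇒MEdge : (L : Matching n) {u v : Fin n} → T (MEdgeB L u v) → MEdge L u v
MEdgeB⇒MEdge L t with find (any⁻ _ L t)
... | (a , b) , ab∈L , ab≈uv with to T-∨ ab≈uv
...   | inj₁ ab≡uv = let a≡u , b≡v = to T-∧ ab≡uv in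
                    inj₁ (subst (_∈ L) (cong₂ _,_ (eqᶠ⇒≡ a≡u) (eqᶠ⇒≡ b≡v)) ab∈L)
...   | inj₂ ab≡vu = let a≡v , b≡u = to T-∧ ab≡vu in
                    inj₂ (subst (_∈ L) (cong₂ _,_ (eqᶠ⇒≡ a≡v) (eqᶠ⇒≡ b≡u)) ab∈L)

MEdge⇒MEdgeB : (L : Matching n) {u v : Fin n} → MEdge L u v → T (MEdgeB L u v)
MEdge⇒MEdgeB L {u} {v} (inj₁ uv∈L) =
  any⁺ _ (lose uv∈L (from T-∨ (inj₁ (from T-∧ (eqᶠ-refl u , eqᶠ-refl v)))))
MEdge⇒MEdgeB L {u} {v} (inj₂ vu∈L) =
  any⁺ _ (lose vu∈L (from T-∨ (inj₂ (from T-∧ (eqᶠ-refl v , eqᶠ-refl u)))))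

module _ (L : Matching n) (S : VSet n) where

  restrict-⊆ : {e : Fin n × Fin n} → e ∈ restrict L S → e ∈ L
  restrict-⊆ e∈ = proj₁ (∈-filter⁻ (T? ∘ inside S) {xs = L} e∈)

  MEdge-restrict⁻ : {v w : Fin n} → MEdge (restrict L S) v w → MEdge L v w
  MEdge-restrict⁻ (inj₁ vw∈) = inj₁ (restrict-⊆ vw∈)
  MEdge-restrict⁻ (inj₂ wv∈) = inj₂ (restrict-⊆ wv∈)

  MEdge-restrict⁺ : {v w : Fin n} → MEdge L v w → T (S v) → T (S w) → MEdge (restrict L S) v w
  MEdge-restrict⁺ (inj₁ vw∈L) v∈S w∈S = inj₁ (∈-filter⁺ (T? ∘ inside S) vw∈L (from T-∧ (v∈S , w∈S)))
  MEdge-restrict⁺ (inj₂ wv∈L) v∈S w∈S = inj₂ (∈-filter⁺ (T? ∘ inside S) wv∈L (from T-∧ (w∈S , v∈S)))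

  ∈-verts-restrict : {v : Fin n} → v ∈ verts (restrict L S) → v ∈ verts L
  ∈-verts-restrict {v} v∈ = proj₁ (MEdge⇒∈-verts (MEdge-restrict⁻ (partner-MEdge (restrict L S) v v∈)))

  MEdge-inside : All (T ∘ inside S) L → {v w : Fin n} → MEdge L v w → T (S v) × T (S w)
  MEdge-inside L⊆S (inj₁ vw∈L) = to T-∧ (All.lookup L⊆S vw∈L)
  MEdge-inside L⊆S (inj₂ wv∈L) = let w∈S , v∈S = to T-∧ (All.lookup L⊆S wv∈L) in v∈S , w∈S

module _ (G : Graph n) {L : Matching n} (L-matching : IsMatching G L) where

  MEdge⇒Edge : {v w : Fin n} → MEdge L v w → Edge G v w
  MEdge⇒Edge (inj₁ vw∈L) = All.lookup (proj₁ L-matching) vw∈L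
  MEdge⇒Edge {v} {w} (inj₂ wv∈L) = subst T (Graph.sym G w v) (All.lookup (proj₁ L-matching) wv∈L)

  partner-moves : {v : Fin n} → v ∈ verts L → partner L v ≢ v
  partner-moves {v} v∈ fixed =
    subst T (irrfl G v) (subst (Edge G v) fixed (MEdge⇒Edge (partner-MEdge L v v∈)))

  partner-Edge : (v : Fin n) → partner L v ≢ v → Edge G v (partner L v)
  partner-Edge v moves with v ∈? verts L
  ... | yes v∈ = MEdge⇒Edge (partner-MEdge L v v∈)
  ... | no v∉  = contradiction (partner-fixed L v v∉) moves

MM≡length-maximum : {G : Graph n} {M : Matching n} → IsMaximumMatching G M →
                    ∀ mm → IsMM G mm → mm ≡ length M
MM≡length-maximum (M-matching , M-maximum) mm ((M′ , M′-matching , refl) , mm-maximum) =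
  ℕ.≤-antisym (M-maximum M′ M′-matching) (mm-maximum _ M-matching)

-- Connected components of G[D]

module Components (G : Graph n) (D : VSet n) where

  -- A record rather than T (reach G D k u v), so that k, u and v can be inferred from a proof.
  record Reach (k : ℕ) (u v : Fin n) : Set where
    constructor mkReach
    field unReach : T (reach G D k u v)
  open Reach

  reach-zero⁻ : {u v : Fin n} → Reach 0 u v → T (D u) × u ≡ v
  reach-zero⁻ (mkReach r) = let u∈D , u≈v = to T-∧ r in u∈D , eqᶠ⇒≡ u≈v

  reach-suc⁻ : {k : ℕ} {u v : Fin n} → Reach (suc k) u v →
               Reach k u v ⊎ ∃ λ w → Reach k u w × Edge G w v × T (D v)
  reach-suc⁻ (mkReach r) with to T-∨ r
  ... | inj₁ r′   = inj₁ (mkReach r′)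
  ... | inj₂ step with any-allFin⁻ _ step
  ...   | w , uw∧wv = let uw , wv∧v∈D = to T-∧ uw∧wv ; wv , v∈D = to T-∧ wv∧v∈D in
                      inj₂ (w , mkReach uw , wv , v∈D)

  reach-suc⁺ : {k : ℕ} {u v : Fin n} → Reach k u v → Reach (suc k) u v
  reach-suc⁺ (mkReach r) = mkReach (from T-∨ (inj₁ r))

  reach-step : {k : ℕ} {u w v : Fin n} → Reach k u w → Edge G w v → T (D v) → Reach (suc k) u v
  reach-step {w = w} (mkReach r) wv v∈D =
    mkReach (from T-∨ (inj₂ (any-allFin⁺ _ w (from T-∧ (r , from T-∧ (wv , v∈D))))))

  reach-∈D : {k : ℕ} {u v : Fin n} → Reach k u v → T (D u) × T (D v)
  reach-∈D {zero} r with reach-zero⁻ r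
  ... | u∈D , refl = u∈D , u∈D
  reach-∈D {suc k} r with reach-suc⁻ r
  ... | inj₁ r′                 = reach-∈D r′
  ... | inj₂ (_ , r′ , _ , v∈D) = proj₁ (reach-∈D r′) , v∈D

  reach-mono : {j k : ℕ} {u v : Fin n} → j ≤ k → Reach j u v → Reach k u v
  reach-mono {k = zero}  z≤n r = r
  reach-mono {k = suc k} z≤n r = reach-suc⁺ (reach-mono z≤n r)
  reach-mono (s≤s j≤k) r with reach-suc⁻ r
  ... | inj₁ r′                  = reach-suc⁺ (reach-mono j≤k r′)
  ... | inj₂ (_ , r′ , wv , v∈D) = reach-step (reach-mono j≤k r′) wv v∈D

  Stable : ℕ → Fin n → Set
  Stable k u = ∀ v → Reach (suc k) u v → Reach k u v

  stable-extends : {k : ℕ} {u : Fin n} → Stable k u → ∀ m {v} → Reach (m + k) u v → Reach k u v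
  stable-extends stable zero    r = r
  stable-extends stable (suc m) r with reach-suc⁻ r
  ... | inj₁ r′                  = stable-extends stable m r′
  ... | inj₂ (_ , r′ , wv , v∈D) = stable _ (reach-step (stable-extends stable m r′) wv v∈D)

  -- Until the reach relation stabilises every step reaches a new vertex, so it stabilises within n steps.
  stable-or-grows : ∀ k u → Stable k u ⊎ count (reach G D k u) < count (reach G D (suc k) u)
  stable-or-grows k u with all? (λ v → T? (reach G D (suc k) u v) →-dec T? (reach G D k u v))
  ... | yes stable   = inj₁ (λ v r → mkReach (stable v (unReach r)))
  ... | no unstable with ¬∀⟶∃¬ n _ (λ v → T? (reach G D (suc k) u v) →-dec T? (reach G D k u v)) unstable
  ...   | v , v-new = let new , ¬old = ¬[⇒] (T? _) v-new in
                      inj₂ (count-mono-< (λ w r → unReach (reach-suc⁺ {k} {u} {w} (mkReach r))) v ¬old new)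

  stable-or-large : ∀ k u → (∃ λ j → j < k × Stable j u) ⊎ k ≤ count (reach G D k u)
  stable-or-large zero    u = inj₂ z≤n
  stable-or-large (suc k) u with stable-or-large k u
  ... | inj₁ (j , j<k , stable) = inj₁ (j , ℕ.m<n⇒m<1+n j<k , stable)
  ... | inj₂ k≤ with stable-or-grows k u
  ...   | inj₁ stable = inj₁ (k , ℕ.n<1+n k , stable)
  ...   | inj₂ grows  = inj₂ (ℕ.<-≤-trans (s≤s k≤) grows)

  stable-within-n : ∀ u → ∃ λ j → j ≤ n × Stable j u
  stable-within-n u with stable-or-large (suc n) u
  ... | inj₁ (j , s≤s j≤n , stable) = j , j≤n , stable
  ... | inj₂ n<                      = contradiction (ℕ.<-≤-trans n< (count-≤ _)) (ℕ.<-irrefl refl)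

  reach-saturates : ∀ m {u v} → Reach m u v → Reach n u v
  reach-saturates m {u} r =
    let j , j≤n , stable = stable-within-n u in
    reach-mono j≤n (stable-extends stable m (reach-mono (ℕ.m≤m+n m j) r))

  Connected : Fin n → Fin n → Set
  Connected = Reach n

  connected? : ∀ u v → Dec (Connected u v)
  connected? u v = map′ mkReach unReach (T? (comp G D u v))

  connected-refl : {u : Fin n} → T (D u) → Connected u u
  connected-refl {u} u∈D = reach-mono z≤n (mkReach (from T-∧ (u∈D , eqᶠ-refl u)))

  connected-step : {u w v : Fin n} → Connected u w → Edge G w v → T (D v) → Connected u v
  connected-step uw wv v∈D = reach-saturates (suc n) (reach-step uw wv v∈D)

  connected-trans : {k : ℕ} {u v w : Fin n} → Connected u v → Reach k v w → Connected u w
  connected-trans {zero} uv vw with reach-zero⁻ vw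
  ... | _ , refl = uv
  connected-trans {suc k} uv vw with reach-suc⁻ vw
  ... | inj₁ vw′                  = connected-trans uv vw′
  ... | inj₂ (_ , vx , xw , w∈D) = connected-step (connected-trans uv vx) xw w∈D

  connected-sym : {k : ℕ} {u v : Fin n} → Reach k u v → Connected v u
  connected-sym {zero} uv with reach-zero⁻ uv
  ... | u∈D , refl = connected-refl u∈D
  connected-sym {suc k} {v = v} uv with reach-suc⁻ uv
  ... | inj₁ uv′                  = connected-sym uv′
  ... | inj₂ (w , uw , wv , v∈D) =
    connected-trans (connected-step (connected-refl v∈D) (subst T (Graph.sym G w v) wv) (proj₂ (reach-∈D uw)))
                    (connected-sym uw)

module _ {i j : Fin n} where
  open Perm using (transpose)

  transpose-i : transpose i j i ≡ j
  transpose-i with i ≟ᶠ i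
  ... | yes _   = refl
  ... | no i≢i = contradiction refl i≢i

  transpose-j : transpose i j j ≡ i
  transpose-j with j ≟ᶠ i
  ... | yes j≡i = j≡i
  ... | no _ with j ≟ᶠ j
  ...   | yes _  = refl
  ...   | no j≢j = contradiction refl j≢j

  transpose-other : {k : Fin n} → k ≢ i → k ≢ j → transpose i j k ≡ k
  transpose-other {k} k≢i k≢j with k ≟ᶠ i
  ... | yes k≡i = contradiction k≡i k≢i
  ... | no _ with k ≟ᶠ j
  ...   | yes k≡j = contradiction k≡j k≢j
  ...   | no _    = refl

  transpose-involutive : (k : Fin n) → transpose i j (transpose i j k) ≡ k
  transpose-involutive k = go (k ≟ᶠ i) (k ≟ᶠ j)
    where
    go : Dec (k ≡ i) → Dec (k ≡ j) → transpose i j (transpose i j k) ≡ k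
    go (yes refl) _          = trans (cong (transpose i j) transpose-i) transpose-j
    go (no _)     (yes refl) = trans (cong (transpose i j) transpose-j) transpose-i
    go (no k≢i)   (no k≢j)   = trans (cong (transpose i j) (transpose-other k≢i k≢j)) (transpose-other k≢i k≢j)

  transpose-preserves : {P : Fin n → Set} → P i → P j → {k : Fin n} → P k → P (transpose i j k)
  transpose-preserves Pi Pj {k} Pk with k ≟ᶠ i
  ... | yes _ = Pj
  ... | no _ with k ≟ᶠ j
  ...   | yes _ = Pi
  ...   | no _  = Pk

least : {P : Fin n → Set} → Decidable P → ∀ v → P v → ∃ λ r → P r × (∀ w → P w → toℕ r ≤ toℕ w)
least {suc n} P? v Pv with P? zero
... | yes P0 = zero , P0 , λ _ _ → z≤n
least {suc n} P? zero    P0 | no ¬P0 = contradiction P0 ¬P0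
least {suc n} P? (suc v) Pv | no ¬P0 =
  let r , Pr , r-least = least (P? ∘ suc) v Pv in
  suc r , Pr , λ { zero P0 → contradiction P0 ¬P0 ; (suc w) Pw → s≤s (r-least w Pw) }

-- Exposed vertices of a relaxed Gallai-Edmonds decomposition

A∩D=∅ : ∀ p → T (isA p) → ¬ T (isD p)
A∩D=∅ inA _ ()

module Decomposition (G : Graph n) (part : Fin n → Part) (M : Matching n)
                     (ged : IsRelaxedGED G part M) where
  open IsRelaxedGED ged

  D : VSet n
  D = Dset G part M

  open Components G D public
  open Reach

  M-matching : IsMatching G M
  M-matching = proj₁ maxM

  Exposed : Fin n → Set
  Exposed u = u ∉ verts M

  exposed? : Decidable Exposed
  exposed? u = ¬? (u ∈? verts M)

  #exposed : ℕ
  #exposed = count (does ∘ exposed?)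

  2|M|+#exposed≡n : length M + length M + #exposed ≡ n
  2|M|+#exposed≡n = begin
    length M + length M + #exposed                     ≡⟨ cong (_+ #exposed) (length-verts M) ⟨
    length (verts M) + #exposed                        ≡⟨ cong (_+ #exposed) (count-∈ (verts M) (proj₂ M-matching)) ⟨
    count (λ v → does (v ∈? verts M)) + #exposed       ≡⟨ count-+-not (λ v → does (v ∈? verts M)) ⟩
    n                                                  ∎
    where open ≡-Reasoning

  exposed⇒∈D : {u : Fin n} → Exposed u → T (D u)
  exposed⇒∈D {u} u∉M with part u in eq
  ... | inA = contradiction (proj₁ (MEdge⇒∈-verts (proj₂ (proj₂ (matA u (subst (T ∘ isA) (sym eq) tt)))))) u∉M
  ... | inB =
    contradiction (∈-verts-restrict M (Bset G part M) (proj₂ (proj₂ perfB) u (subst (T ∘ isB) (sym eq) tt))) u∉M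
  ... | inD = tt

  matched⁻ : {r : Fin n} → T (matchedB G part M r) →
             ∃ λ c → ∃ λ a → Connected r c × T (Aset G part M a) × MEdge M c a
  matched⁻ {r} matched =
    let c , rc∧ca = any-allFin⁻ (λ c → comp G D r c ∧ any (λ a → Aset G part M a ∧ MEdgeB M c a) (allFin n))
                                matched
        rc , ∃a    = to T-∧ rc∧ca
        a , a∈A∧ca = any-allFin⁻ (λ a → Aset G part M a ∧ MEdgeB M c a) ∃a
        a∈A , ca   = to T-∧ a∈A∧ca
    in c , a , mkReach rc , a∈A , MEdgeB⇒MEdge M ca

  matched⁺ : {r c a : Fin n} → Connected r c → T (Aset G part M a) → MEdge M c a → T (matchedB G part M r)
  matched⁺ {c = c} {a} rc a∈A ca =
    any-allFin⁺ _ c (from T-∧ (unReach rc , any-allFin⁺ _ a (from T-∧ (a∈A , MEdge⇒MEdgeB M ca))))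

  -- The M-partner of w can be neither in the component (w∉), nor elsewhere in D (it would be in the
  -- component), nor in A = N(D) (the component would be matched).
  unmatched-component-exposed : {r w : Fin n} → ¬ T (matchedB G part M r) → Connected r w →
                                w ∉ verts (restrict M (comp G D r)) → Exposed w
  unmatched-component-exposed {r} {w} unmatched rw w∉ w∈M = partner-placed (T? (comp G D r y)) (T? (D y))
    where
    y = partner M w
    wy = partner-MEdge M w w∈M
    wy-edge = MEdge⇒Edge G M-matching wy
    partner-placed : Dec (T (comp G D r y)) → Dec (T (D y)) → ⊥
    partner-placed (yes ry) _         = w∉ (proj₁ (MEdge⇒∈-verts (MEdge-restrict⁺ M (comp G D r) wy (unReach rw) ry)))
    partner-placed (no ¬ry) (yes y∈D) = ¬ry (unReach (connected-step rw wy-edge y∈D))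
    partner-placed (no _)   (no y∉D)  = unmatched (matched⁺ rw (N⇒A y y∉D (w , proj₂ (reach-∈D rw) , wy-edge)) wy)

  module _ {u : Fin n} (u-exposed : Exposed u) where
    private
      C = comp G D u
      C-near-perfect = nearC u (exposed⇒∈D u-exposed)

    exposed-component-covered : {v : Fin n} → Connected u v → v ≢ u → v ∈ verts (restrict M C)
    exposed-component-covered {v} uv v≢u =
      covers v (unReach uv) (λ v≡w → v≢u (trans v≡w (sym u≡w)))
      where
      w = proj₁ (proj₂ (proj₂ C-near-perfect))
      covers = proj₂ (proj₂ (proj₂ (proj₂ (proj₂ C-near-perfect))))
      u≡w : u ≡ w
      u≡w with u ≟ᶠ w
      ... | yes u≡w = u≡w
      ... | no u≢w  =
        contradiction (∈-verts-restrict M C (covers u (unReach (connected-refl (exposed⇒∈D u-exposed))) u≢w))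
                      u-exposed

    exposed-unique : {v : Fin n} → Connected u v → Exposed v → v ≡ u
    exposed-unique {v} uv v-exposed with v ≟ᶠ u
    ... | yes v≡u = v≡u
    ... | no v≢u  = contradiction (∈-verts-restrict M C (exposed-component-covered uv v≢u)) v-exposed

    partner-connected : {w y : Fin n} → Connected u w → MEdge M w y → Connected u y
    partner-connected {w} {y} uw wy =
      mkReach (subst (T ∘ C) y′≡y (proj₂ (MEdge-inside (restrict M C) C C-inside wy′)))
      where
      C-inside = proj₁ (proj₂ C-near-perfect)
      w≢u : w ≢ u
      w≢u w≡u = u-exposed (subst (_∈ verts M) w≡u (proj₁ (MEdge⇒∈-verts wy)))
      wy′ = partner-MEdge (restrict M C) w (exposed-component-covered uw w≢u)
      y′≡y : partner (restrict M C) w ≡ y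
      y′≡y = trans (sym (partner-unique M (proj₂ M-matching) (MEdge-restrict⁻ M C wy′)))
                   (partner-unique M (proj₂ M-matching) wy)

    exposed-component-unmatched : {r : Fin n} → Connected u r → ¬ T (matchedB G part M r)
    exposed-component-unmatched ur matched =
      let c , a , rc , a∈A , ca = matched⁻ matched
          ua = partner-connected (connected-trans ur rc) ca
      in A∩D=∅ (part a) a∈A (proj₂ (reach-∈D ua))

  exposed-same : {u u′ w : Fin n} → Exposed u → Exposed u′ → Connected u w → Connected u′ w → u ≡ u′
  exposed-same u-exposed u′-exposed uw u′w =
    sym (exposed-unique u-exposed (connected-trans uw (connected-sym u′w)) u′-exposed)

  ExposedComponent : Fin n → Set
  ExposedComponent w = ∃ λ u → Exposed u × Connected u w

  exposedComponent? : Decidable ExposedComponent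
  exposedComponent? w = any? (λ u → exposed? u ×-dec connected? u w)

  outside⇒covered : {v : Fin n} → ¬ ExposedComponent v → v ∈ verts M
  outside⇒covered {v} outside-v = decidable-stable (v ∈? verts M)
    (λ v-exposed → outside-v (v , v-exposed , connected-refl (exposed⇒∈D v-exposed)))

  -- Exposure proofs are irrelevant and a component has only one exposed vertex (exposed-same), so the
  -- value does not depend on the witness found.
  componentwise : (∀ u → .(Exposed u) → Fin n → Fin n) → (Fin n → Fin n) → Fin n → Fin n
  componentwise inside outside w with exposedComponent? w
  ... | yes (u , u-exposed , _) = inside u u-exposed w
  ... | no _                    = outside w

  module _ {inside : ∀ u → .(Exposed u) → Fin n → Fin n} {outside : Fin n → Fin n} where

    componentwise-inside : {u w : Fin n} (u-exposed : Exposed u) → Connected u w →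
                           componentwise inside outside w ≡ inside u u-exposed w
    componentwise-inside {u} {w} u-exposed uw with exposedComponent? w
    ... | yes (u′ , u′-exposed , u′w) with refl ← exposed-same u′-exposed u-exposed u′w uw = refl
    ... | no none = contradiction (u , u-exposed , uw) none

    componentwise-outside : {w : Fin n} → ¬ ExposedComponent w → componentwise inside outside w ≡ outside w
    componentwise-outside {w} outside-w with exposedComponent? w
    ... | yes inside-w = contradiction inside-w outside-w
    ... | no _         = refl

  -- exchange swaps, in each exposed component, the exposed vertex with the chosen one; being an
  -- involution it maps the exposed vertices bijectively onto the chosen ones.
  module Chosen (choose : ∀ u → .(Exposed u) → Fin n)
                (choose-connected : ∀ {u} (u-exposed : Exposed u) → Connected u (choose u u-exposed)) where
    open Perm using (transpose)

    IsChosen : Fin n → Set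
    IsChosen w = ∃ λ u → Σ (Exposed u) λ u-exposed → choose u u-exposed ≡ w

    exchange : Fin n → Fin n
    exchange = componentwise (λ u u-exposed → transpose u (choose u u-exposed)) id

    exchange-inside : {u w : Fin n} (u-exposed : Exposed u) → Connected u w →
                      exchange w ≡ transpose u (choose u u-exposed) w
    exchange-inside = componentwise-inside

    exchange-involutive : ∀ v → exchange (exchange v) ≡ v
    exchange-involutive v = involutive-at (exposedComponent? v)
      where
      open ≡-Reasoning
      involutive-at : Dec (ExposedComponent v) → exchange (exchange v) ≡ v
      involutive-at (yes (u , u-exposed , uv)) = begin
        exchange (exchange v)            ≡⟨ cong exchange (exchange-inside u-exposed uv) ⟩
        exchange (transpose u c v)       ≡⟨ exchange-inside u-exposed c-v-connected ⟩
        transpose u c (transpose u c v)  ≡⟨ transpose-involutive v ⟩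
        v                                ∎
        where
        c = choose u u-exposed
        c-v-connected = transpose-preserves {P = Connected u}
                          (connected-refl (exposed⇒∈D u-exposed)) (choose-connected u-exposed) uv
      involutive-at (no outside-v) =
        trans (cong exchange (componentwise-outside outside-v)) (componentwise-outside outside-v)

    #chosen≡#exposed : {P : Fin n → Set} (P? : Decidable P) → (∀ w → P w ⇔ IsChosen w) →
                       count (does ∘ P?) ≡ #exposed
    #chosen≡#exposed P? P⇔chosen =
      trans (count-∘-involution exchange exchange-involutive (does ∘ P?))
            (count-cong (P? ∘ exchange) exposed?
              (λ v → mk⇔ (exchanged⇒exposed v ∘ to (P⇔chosen _)) (from (P⇔chosen _) ∘ exposed⇒exchanged)))
      where
      exchange-exposed : {u : Fin n} (u-exposed : Exposed u) → exchange u ≡ choose u u-exposed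
      exchange-exposed {u} u-exposed =
        trans (exchange-inside u-exposed (connected-refl (exposed⇒∈D u-exposed)))
              (transpose-i {i = u} {j = choose u u-exposed})
      exchange-chosen : {u : Fin n} (u-exposed : Exposed u) → exchange (choose u u-exposed) ≡ u
      exchange-chosen {u} u-exposed =
        trans (exchange-inside u-exposed (choose-connected u-exposed)) (transpose-j {i = u} {j = choose u u-exposed})
      exposed⇒exchanged : {v : Fin n} → Exposed v → IsChosen (exchange v)
      exposed⇒exchanged {v} v-exposed = v , v-exposed , sym (exchange-exposed v-exposed)
      exchanged⇒exposed : (v : Fin n) → IsChosen (exchange v) → Exposed v
      exchanged⇒exposed v (u , u-exposed , c≡) =
        subst Exposed (trans (sym (exchange-chosen u-exposed)) (trans (cong exchange c≡) (exchange-involutive v))) u-exposed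

  component-least : (u : Fin n) → .(Exposed u) →
                    ∃ λ r → Connected u r × (∀ w → Connected u w → toℕ r ≤ toℕ w)
  component-least u u-exposed =
    least (connected? u) u (connected-refl (exposed⇒∈D (recompute (exposed? u) u-exposed)))

  module _ (nice : Nice G part M) where

    exposed-component-nontrivial : {u : Fin n} → Exposed u → ∃ λ v → Connected u v × v ≢ u
    exposed-component-nontrivial {u} u-exposed with all? (λ v → connected? u v →-dec v ≟ᶠ u)
    ... | yes trivial = contradiction (u , u∈D , unmatched , λ v uv → trivial v (mkReach uv)) nice
      where
      u∈D = exposed⇒∈D u-exposed
      unmatched = ¬T⇒T-not (exposed-component-unmatched u-exposed (connected-refl u∈D))
    ... | no nontrivial =
      let v , v-witness = ¬∀⟶∃¬ n _ (λ v → connected? u v →-dec v ≟ᶠ u) nontrivial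
      in v , ¬[⇒] (connected? u v) v-witness

    isC3Representative : Fin n → Bool
    isC3Representative r = D r ∧ repB G part M r ∧ not (matchedB G part M r) ∧ nontrivB G part M r

    IsC3Representative : Fin n → Set
    IsC3Representative = T ∘ isC3Representative

    open Chosen (λ u u-exposed → proj₁ (component-least u u-exposed))
                (λ u-exposed → proj₁ (proj₂ (component-least _ u-exposed)))

    least-is-C3-representative : {u : Fin n} (u-exposed : Exposed u) →
                                 IsC3Representative (proj₁ (component-least u u-exposed))
    least-is-C3-representative {u} u-exposed =
      from T-∧ (proj₂ (reach-∈D ur) , from T-∧ (r-least , from T-∧ (r-unmatched , r-nontrivial)))
      where
      r = proj₁ (component-least u u-exposed)
      ur = proj₁ (proj₂ (component-least u u-exposed))
      r-minimal = proj₂ (proj₂ (component-least u u-exposed))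
      r-least-in : ∀ w → T (not (comp G D r w) ∨ (toℕ r ≤ᵇ toℕ w))
      r-least-in w with T? (comp G D r w)
      ... | yes rw = from T-∨ (inj₂ (ℕ.≤⇒≤ᵇ (r-minimal w (connected-trans ur (mkReach {k = n} rw)))))
      ... | no ¬rw = from T-∨ (inj₁ (¬T⇒T-not ¬rw))
      r-least = all-allFin⁺ _ r-least-in
      r-unmatched = ¬T⇒T-not (exposed-component-unmatched u-exposed ur)
      r-nontrivial : T (nontrivB G part M r)
      r-nontrivial with exposed-component-nontrivial u-exposed
      ... | v , uv , v≢u with v ≟ᶠ r
      ...   | no v≢r  =
        any-allFin⁺ _ v (from T-∧ (unReach (connected-trans (connected-sym ur) uv) , ≢⇒T-not-eqᶠ (v≢r ∘ sym)))
      ...   | yes v≡r =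
        any-allFin⁺ _ u (from T-∧ (unReach (connected-sym ur) , ≢⇒T-not-eqᶠ (λ r≡u → v≢u (trans v≡r r≡u))))

    unmatched-representative⇒chosen : {r : Fin n} → T (D r) → T (repB G part M r) →
                                      ¬ T (matchedB G part M r) → IsChosen r
    unmatched-representative⇒chosen {r} r∈D r-least r-unmatched =
      w , w-exposed , toℕ-injective (ℕ.≤-antisym c≤r r≤c)
      where
      near-perfect = nearC r r∈D
      w = proj₁ (proj₂ (proj₂ near-perfect))
      rw = mkReach (proj₁ (proj₂ (proj₂ (proj₂ near-perfect))))
      w-exposed = unmatched-component-exposed r-unmatched rw (proj₁ (proj₂ (proj₂ (proj₂ (proj₂ near-perfect)))))
      c = proj₁ (component-least w w-exposed)
      c≤r = proj₂ (proj₂ (component-least w w-exposed)) r (connected-sym rw)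
      rc = connected-trans rw (proj₁ (proj₂ (component-least w w-exposed)))
      r≤c : toℕ r ≤ toℕ c
      r≤c with to T-∨ (all-allFin⁻ _ r-least c)
      ... | inj₁ ¬rc  = contradiction (unReach rc) (T-not⇒¬T ¬rc)
      ... | inj₂ r≤ᵇc = ℕ.≤ᵇ⇒≤ (toℕ r) (toℕ c) r≤ᵇc

    C3-representative⇒chosen : {r : Fin n} → IsC3Representative r → IsChosen r
    C3-representative⇒chosen is-rep =
      let r∈D , rest = to T-∧ is-rep ; r-least , rest′ = to T-∧ rest
      in unmatched-representative⇒chosen r∈D r-least (T-not⇒¬T (proj₁ (to T-∧ rest′)))

    chosen⇒C3-representative : {r : Fin n} → IsChosen r → IsC3Representative r
    chosen⇒C3-representative (u , u-exposed , c≡r) =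
      subst IsC3Representative c≡r (least-is-C3-representative u-exposed)

    C3count≡#exposed : C3count G part M ≡ #exposed
    C3count≡#exposed = trans (size≡count isC3Representative)
      (#chosen≡#exposed (T? ∘ isC3Representative) (λ r → mk⇔ C3-representative⇒chosen chosen⇒C3-representative))

    module Pairing {Good : Fin n → Set} (good? : Decidable Good)
                   (edge-good : ∀ u v → Edge G u v → Good u ⊎ Good v) where

      exposed-component-good : {u : Fin n} → Exposed u → ∃ λ z → Connected u z × Good z
      exposed-component-good {u} u-exposed = endpoint-good (edge-good u y (MEdge⇒Edge G P-matching uy))
        where
        u∈D = exposed⇒∈D u-exposed
        nontrivial = exposed-component-nontrivial u-exposed
        v = proj₁ nontrivial
        perfect = fc u u∈D v (unReach (proj₁ (proj₂ nontrivial)))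
        P = proj₁ perfect
        P-matching = proj₁ (proj₂ perfect)
        P-inside = proj₁ (proj₂ (proj₂ perfect))
        u∈P = proj₂ (proj₂ (proj₂ perfect)) u
                (∈-─⁺ {S = comp G D u} (unReach (connected-refl u∈D)) (proj₂ (proj₂ nontrivial) ∘ sym))
        y = partner P u
        uy = partner-MEdge P u u∈P
        endpoint-good : Good u ⊎ Good y → ∃ λ z → Connected u z × Good z
        endpoint-good (inj₁ u-good) = u , connected-refl u∈D , u-good
        endpoint-good (inj₂ y-good) =
          y , mkReach (proj₁ (∈-─⁻ {S = comp G D u} (proj₂ (MEdge-inside P (comp G D u ─ v) P-inside uy)))) , y-good

      record Split (u : Fin n) : Set where
        field
          centre           : Fin n
          centre-connected : Connected u centre
          centre-good      : Good centre
          rest             : Matching n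
          rest-perfect     : PerfectMatchingOf G (comp G D u ─ centre) rest

        rest-matching : IsMatching G rest
        rest-matching = proj₁ rest-perfect

        rest-inside : {v w : Fin n} → MEdge rest v w → Connected u w × w ≢ centre
        rest-inside vw =
          let w∈C , w≢c = ∈-─⁻ {S = comp G D u}
                            (proj₂ (MEdge-inside rest (comp G D u ─ centre) (proj₁ (proj₂ rest-perfect)) vw))
          in mkReach w∈C , w≢c

        partner-rest-connected : {v : Fin n} → Connected u v → Connected u (partner rest v)
        partner-rest-connected {v} uv with v ∈? verts rest
        ... | yes v∈ = proj₁ (rest-inside (partner-MEdge rest v v∈))
        ... | no v∉  = subst (Connected u) (sym (partner-fixed rest v v∉)) uv

        rest-covers : {v : Fin n} → Connected u v → v ≢ centre → v ∈ verts rest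
        rest-covers uv v≢c = proj₂ (proj₂ rest-perfect) _ (∈-─⁺ {S = comp G D u} (unReach uv) v≢c)

        centre-uncovered : centre ∉ verts rest
        centre-uncovered c∈ = proj₂ (rest-inside (MEdge-sym (partner-MEdge rest centre c∈))) refl

      split : (u : Fin n) → .(Exposed u) → Split u
      split u u-exposed with any? (λ z → connected? u z ×-dec good? z)
      ... | yes (z , uz , z-good) = record
        { centre = z ; centre-connected = uz ; centre-good = z-good
        ; rest = proj₁ perfect ; rest-perfect = proj₂ perfect }
        where perfect = fc u (exposed⇒∈D (recompute (exposed? u) u-exposed)) z (unReach uz)
      ... | no none = contradiction (exposed-component-good (recompute (exposed? u) u-exposed)) none

      σ : Fin n → Fin n
      σ = componentwise (λ u u-exposed → partner (Split.rest (split u u-exposed))) (partner M)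

      module Centres = Chosen (λ u u-exposed → Split.centre (split u u-exposed))
                              (λ u-exposed → Split.centre-connected (split _ u-exposed))

      σ-Edge : ∀ v → σ v ≢ v → Edge G v (σ v)
      σ-Edge v = at (exposedComponent? v)
        where
        edge-along : {L : Matching n} → IsMatching G L → σ v ≡ partner L v → σ v ≢ v → Edge G v (σ v)
        edge-along L-matching σ≡ moves =
          subst (Edge G v) (sym σ≡) (partner-Edge G L-matching v (λ fixed → moves (trans σ≡ fixed)))
        at : Dec (ExposedComponent v) → σ v ≢ v → Edge G v (σ v)
        at (yes (u , u-exposed , uv)) =
          edge-along (Split.rest-matching (split u u-exposed)) (componentwise-inside u-exposed uv)
        at (no outside-v) = edge-along M-matching (componentwise-outside outside-v)

      σ-involutive : ∀ v → σ (σ v) ≡ v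
      σ-involutive v = at (exposedComponent? v)
        where
        open ≡-Reasoning
        at : Dec (ExposedComponent v) → σ (σ v) ≡ v
        at (yes (u , u-exposed , uv)) = begin
          σ (σ v)                      ≡⟨ cong σ (componentwise-inside u-exposed uv) ⟩
          σ (partner rest v)           ≡⟨ componentwise-inside u-exposed (partner-rest-connected uv) ⟩
          partner rest (partner rest v) ≡⟨ partner-involutive rest (proj₂ rest-matching) v ⟩
          v                            ∎
          where open Split (split u u-exposed)
        at (no outside-v) = begin
          σ (σ v)                      ≡⟨ cong σ (componentwise-outside outside-v) ⟩
          σ (partner M v)              ≡⟨ componentwise-outside outside-partner ⟩
          partner M (partner M v)      ≡⟨ partner-unique M (proj₂ M-matching) (MEdge-sym vy) ⟩
          v                            ∎
          where
          vy = partner-MEdge M v (outside⇒covered outside-v)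
          outside-partner : ¬ ExposedComponent (partner M v)
          outside-partner (u , u-exposed , uy) = outside-v (u , u-exposed , partner-connected u-exposed uy (MEdge-sym vy))

      σ-fixed⇔centre : ∀ w → σ w ≡ w ⇔ Centres.IsChosen w
      σ-fixed⇔centre w = mk⇔ (fixed⇒centre (exposedComponent? w)) centre⇒fixed
        where
        fixed⇒centre : Dec (ExposedComponent w) → σ w ≡ w → Centres.IsChosen w
        fixed⇒centre (yes (u , u-exposed , uw)) fixed with w ≟ᶠ Split.centre (split u u-exposed)
        ... | yes w≡c = u , u-exposed , sym w≡c
        ... | no w≢c  = contradiction (trans (sym (componentwise-inside u-exposed uw)) fixed)
                          (partner-moves G rest-matching (rest-covers uw w≢c))
          where open Split (split u u-exposed)
        fixed⇒centre (no outside-w) fixed =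
          contradiction (trans (sym (componentwise-outside outside-w)) fixed)
                        (partner-moves G M-matching (outside⇒covered outside-w))
        centre⇒fixed : Centres.IsChosen w → σ w ≡ w
        centre⇒fixed (u , u-exposed , refl) =
          trans (componentwise-inside u-exposed centre-connected) (partner-fixed rest centre centre-uncovered)
          where open Split (split u u-exposed)

      σ-fixed⇒good : {w : Fin n} → σ w ≡ w → Good w
      σ-fixed⇒good {w} fixed =
        let u , u-exposed , c≡w = to (σ-fixed⇔centre w) fixed
        in subst Good c≡w (Split.centre-good (split u u-exposed))

      #σ-fixed≡#exposed : count (λ v → does (σ v ≟ᶠ v)) ≡ #exposed
      #σ-fixed≡#exposed = Centres.#chosen≡#exposed (λ v → σ v ≟ᶠ v) σ-fixed⇔centre

    vertex-cover-bound : (S : VSet n) → IsVertexCover G S → length M + #exposed ≤ size S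
    vertex-cover-bound S cover = ℕhalve-≤ (begin
      (length M + #exposed) + (length M + #exposed)    ≡⟨ regroup (length M) #exposed ⟩
      (length M + length M + #exposed) + #exposed      ≡⟨ cong (_+ #exposed) 2|M|+#exposed≡n ⟩
      n + #exposed                                     ≡⟨ cong₂ _+_ (count-all {n}) #σ-fixed≡#exposed ⟨
      count {n} (λ _ → true) + count (λ v → does (σ v ≟ᶠ v))
        ≡⟨ ℕΣ.∑-distrib-+ {n} (λ _ → 1) (λ v → indicator (does (σ v ≟ᶠ v))) ⟨
      ℕΣ.sum (λ v → 1 + indicator (does (σ v ≟ᶠ v)))   ≤⟨ ℕsum-≤-pairs σ σ-involutive covers-pair ⟩
      count S + count S                                ≡⟨ cong₂ _+_ (size≡count S) (size≡count S) ⟨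
      size S + size S                                  ∎)
      where
      open ℕ.≤-Reasoning
      open Pairing (T? ∘ S) (λ u v uv → to (T-∨ {S u}) (cover u v uv))
      regroup : ∀ a b → (a + b) + (a + b) ≡ (a + a + b) + b
      regroup = solve-∀
      covers-pair : ∀ v → 1 + indicator (does (σ v ≟ᶠ v)) ≤ indicator (S v) + indicator (S (σ v))
      covers-pair v with σ v ≟ᶠ v
      ... | yes fixed rewrite fixed = ℕ.+-mono-≤ v∈S v∈S
        where v∈S = indicator-mono {true} {S v} (λ _ → σ-fixed⇒good fixed)
      ... | no moves with to (T-∨ {S v}) (cover v (σ v) (σ-Edge v moves))
      ...   | inj₁ v∈S  = ℕ.≤-trans (indicator-mono {true} {S v} (λ _ → v∈S)) (ℕ.m≤m+n _ _)
      ...   | inj₂ σv∈S = ℕ.≤-trans (indicator-mono {true} {S (σ v)} (λ _ → σv∈S)) (ℕ.m≤n+m _ _)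

    fractional-cover-bound : (x : Fin n → ℚ) → FracCover G x → (+ n) / 2 ≤ℚ cost x
    fractional-cover-bound x (_ , cover) = ℚhalve-≤ (begin
      (+ n) / 2 +ℚ (+ n) / 2                  ≡⟨ cong₂ _+ℚ_ (sum-½ n) (sum-½ n) ⟨
      ℚΣ.sum {n} (λ _ → ½) +ℚ ℚΣ.sum {n} (λ _ → ½)
                                              ≡⟨ ℚΣ.∑-distrib-+ {n} (λ _ → ½) (λ _ → ½) ⟨
      ℚΣ.sum {n} (λ _ → 1ℚ)                   ≤⟨ ℚsum-≤-pairs σ σ-involutive covers-pair ⟩
      ℚΣ.sum x +ℚ ℚΣ.sum x                    ≡⟨ cong₂ _+ℚ_ (cost≡sum x) (cost≡sum x) ⟨
      cost x +ℚ cost x                        ∎)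
      where
      open ℚ.≤-Reasoning
      heavy-end : ∀ u v → Edge G u v → ½ ≤ℚ x u ⊎ ½ ≤ℚ x v
      heavy-end u v uv with ½ ℚ.≤? x u | ½ ℚ.≤? x v
      ... | yes ½≤xu | _         = inj₁ ½≤xu
      ... | no _     | yes ½≤xv  = inj₂ ½≤xv
      ... | no ½≰xu  | no ½≰xv   =
        contradiction (ℚ.<-≤-trans (ℚ.+-mono-< (ℚ.≰⇒> ½≰xu) (ℚ.≰⇒> ½≰xv)) (cover u v uv)) (ℚ.<-irrefl refl)
      open Pairing (λ z → ½ ℚ.≤? x z) heavy-end
      covers-pair : ∀ v → 1ℚ ≤ℚ x v +ℚ x (σ v)
      covers-pair v with σ v ≟ᶠ v
      ... | yes fixed rewrite fixed = ℚ.+-mono-≤ (σ-fixed⇒good fixed) (σ-fixed⇒good fixed)  -- ½ +ℚ ½ is 1ℚ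
      ... | no moves  = cover v (σ v) (σ-Edge v moves)

    LP≡n/2 : IsLP G ((+ n) / 2)
    LP≡n/2 = ((λ _ → ½) , half-cover , trans (cost≡sum {n} (λ _ → ½)) (sum-½ n)) , fractional-cover-bound
      where
      half-cover : FracCover G (λ _ → ½)
      half-cover = (λ _ → ℚ.nonNegative⁻¹ ½) , (λ _ _ _ → ℚ.≤-refl)

lemma13 : ∀ {n} (G : Graph n) (part : Fin n → Part) (M : Matching n) →
          IsRelaxedGED G part M → Nice G part M →
          (∀ mm → IsMM G mm → IsLP G ((+ (length M + C3count G part M + mm)) / 2)) ×
          (∀ S → IsVertexCover G S → length M + C3count G part M ≤ size S)
lemma13 {n} G part M ged nice = LP , vertex-cover
  where
  open Decomposition G part M ged
  open ≡-Reasoning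
  |M|+C3+MM≡n : ∀ mm → IsMM G mm → length M + C3count G part M + mm ≡ n
  |M|+C3+MM≡n mm is-mm = begin
    length M + C3count G part M + mm   ≡⟨ cong₂ (λ c k → length M + c + k) (C3count≡#exposed nice)
                                                  (MM≡length-maximum {G = G} (IsRelaxedGED.maxM ged) mm is-mm) ⟩
    length M + #exposed + length M     ≡⟨ regroup (length M) #exposed ⟩
    length M + length M + #exposed     ≡⟨ 2|M|+#exposed≡n ⟩
    n                                  ∎
    where
    regroup : ∀ a c → a + c + a ≡ a + a + c
    regroup = solve-∀
  LP : ∀ mm → IsMM G mm → IsLP G ((+ (length M + C3count G part M + mm)) / 2)
  LP mm is-mm = subst (λ k → IsLP G ((+ k) / 2)) (sym (|M|+C3+MM≡n mm is-mm)) (LP≡n/2 nice)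
  vertex-cover : ∀ S → IsVertexCover G S → length M + C3count G part M ≤ size S
  vertex-cover S cover =
    subst (λ c → length M + c ≤ size S) (sym (C3count≡#exposed nice)) (vertex-cover-bound nice S cover)
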